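{- Let $I$ be an ordinal and let $(X_i)_{i\in I}$ be a family of generalized ordered sets. Let $\mathscr{L}$ be any collection of initial segments of $I$. Suppose that for each finite subcollection $\{A_0,\dots,A_m\}$ of $\mathscr{L}$, the product $\prod_{i\in A_0\cup\dots\cup A_m}X_i$ with its lexicographic order is a generalized ordered set. Then the lexicographic order on $\prod_{i\in\bigcup\mathscr{L}}X_i$ is asymmetric and transitive. If, in addition, the relation $<$ on each $X_i$ is cotransitive, then the lexicographic order on $\prod_{i\in\bigcup\mathscr{L}}X_i$ is positively antisymmetric.
   Context: The setting is constructive mathematics: no use of the law of excluded middle. An ordinal is taken in the sense of the Homotopy Type Theory book: a set $I$ with a binary relation $<$ that is transitive, extensional and well-founded (every element accessible). For a set $X$ with a binary relation $<$, write $x\leq_{P}y$ if for all $z\in X$, $z<x$ implies $z<y$, and $y<z$ implies $x<z$. A generalized ordered set is a set $X$ with a binary relation $<$ that is asymmetric ($x<y$ implies $\neg(y<x)$), transitive ($x<y<z$ implies $x<z$) and positively antisymmetric ($x\leq_{P}y$ and $y\leq_{P}x$ imply $x=y$). A relation is cotransitive if $a<b$ implies $a<c$ or $c<b$. An initial segment of $I$ is a subset $S\subseteq I$ such that $s'\leq_{P}s\in S$ implies $s'\in S$. For $A\subseteq I$, $\prod_{i\in A}X_i$ is the set of functions $f$ on $A$ with $f(i)\in X_i$, with pointwise equality. Its lexicographic order is: $f<g$ iff there is $k\in A$ with $f(k)<g(k)$ and $f(j)=g(j)$ for all $j\in A$ with $j<k$. -}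

module Defs where

open import Data.Nat using (ℕ; suc)
open import Data.Fin using (Fin)
open import Data.Product using (Σ; _×_; _,_)
open import Data.Sum using (_⊎_)
open import Relation.Nullary using (¬_)
open import Relation.Binary.PropositionalEquality using (_≡_)
open import Induction.WellFounded using (WellFounded)

-- Order-theoretic notions on a type T with an equality _≈_ and a
-- relation _<_ (the equality is a parameter because the product carries
-- pointwise equality).

_≤P⟨_⟩_ : {T : Set} → T → (T → T → Set) → T → Set
x ≤P⟨ _<_ ⟩ y = ∀ z → (z < x → z < y) × (y < z → x < z)

Asymmetric : {T : Set} → (T → T → Set) → Set
Asymmetric {T} _<_ = ∀ {x y : T} → x < y → ¬ (y < x)

Transitive : {T : Set} → (T → T → Set) → Set
Transitive {T} _<_ = ∀ {x y z : T} → x < y → y < z → x < z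

PosAntisymmetric : {T : Set} → (T → T → Set) → (T → T → Set) → Set
PosAntisymmetric {T} _≈_ _<_ =
  ∀ {x y : T} → x ≤P⟨ _<_ ⟩ y → y ≤P⟨ _<_ ⟩ x → x ≈ y

Cotransitive : {T : Set} → (T → T → Set) → Set
Cotransitive {T} _<_ = ∀ {a b : T} → a < b → (c : T) → (a < c) ⊎ (c < b)

record IsGOS {T : Set} (_≈_ : T → T → Set) (_<_ : T → T → Set) : Set where
  field
    asym     : Asymmetric _<_
    trans    : Transitive _<_
    posAnti  : PosAntisymmetric _≈_ _<_

-- Ordinals in the sense of the HoTT book

record IsOrdinal (I : Set) (_<_ : I → I → Set) : Set where
  field
    trans  : Transitive _<_
    ext    : ∀ {a b : I} → (∀ c → (c < a → c < b) × (c < b → c < a)) → a ≡ b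
    wf     : WellFounded _<_

Subset : Set → Set₁
Subset I = I → Set

IsInitialSegment : {I : Set} → (I → I → Set) → Subset I → Set
IsInitialSegment {I} _<_ S = ∀ {s' s : I} → s' ≤P⟨ _<_ ⟩ s → S s → S s'

⋃ : {I L : Set} → (L → Subset I) → Subset I
⋃ {L = L} Seg i = Σ L (λ l → Seg l i)

⋃fin : {I L : Set} → (L → Subset I) → (m : ℕ) → (Fin (suc m) → L) → Subset I
⋃fin Seg m c i = Σ (Fin (suc m)) (λ k → Seg (c k) i)

module _ {I : Set} (X : I → Set) where

  -- a function on A: its value may not depend on the membership proof
  record Π[_] (A : Subset I) : Set where
    constructor mkΠ
    field
      app : (i : I) → A i → X i
      coh : ∀ i (a b : A i) → app i a ≡ app i b
  open Π[_] public

  _≈Π_ : {A : Subset I} → Π[ A ] → Π[ A ] → Set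
  _≈Π_ {A} f g = ∀ i (a : A i) → app f i a ≡ app g i a

  Lex : (_<I_ : I → I → Set) (_<X_ : ∀ {i} → X i → X i → Set)
        {A : Subset I} → Π[ A ] → Π[ A ] → Set
  Lex _<I_ _<X_ {A} f g =
    Σ I λ k → Σ (A k) λ a →
      (app f k a <X app g k a) × (∀ j (b : A j) → j <I k → app f j b ≡ app g j b)

-- Asymmetry and transitivity are witnessed by two keys, each lying in a single
-- segment, so both comparisons already live in the product over the union of
-- two segments, where they are known to hold; as the segments are initial,
-- agreement below the key transfers back to the whole union. Positive
-- antisymmetry needs no hypothesis on finite unions: by well-founded induction
-- f and g agree below i, so f i < g i would give f < g ≤P f, i.e. f < f;
-- cotransitivity turns the two resulting non-inequalities at i into
-- f i ≤P g i and g i ≤P f i.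
module Submission where

open import Defs
open import Data.Nat using (ℕ; suc)
open import Data.Fin using (Fin; zero; suc)
open import Data.Vec.Functional using ([]; _∷_)
open import Data.Product using (_×_; _,_; proj₁)
open import Data.Sum using (fromInj₁; fromInj₂)
open import Function using (_∘_)
open import Data.Empty using (⊥-elim)
open import Relation.Nullary using (¬_)
open import Relation.Binary.PropositionalEquality using (_≡_; sym; trans; subst₂)
open import Induction.WellFounded using (WellFounded; module All)

<⇒≤P : {T : Set} {_<_ : T → T → Set} → Transitive _<_ →
       ∀ {x y} → x < y → x ≤P⟨ _<_ ⟩ y
<⇒≤P <-trans x<y z = (λ z<x → <-trans z<x x<y) , (λ y<z → <-trans x<y y<z)

≮⇒≤P : {T : Set} {_<_ : T → T → Set} → Cotransitive _<_ →
       ∀ {x y} → ¬ (y < x) → x ≤P⟨ _<_ ⟩ y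
≮⇒≤P cot {x} {y} y≮x z =
  (λ z<x → fromInj₁ (⊥-elim ∘ y≮x) (cot z<x y)) ,
  (λ y<z → fromInj₂ (⊥-elim ∘ y≮x) (cot y<z x))

⋃fin-initial : {I L : Set} {_<I_ : I → I → Set} {Seg : L → Subset I} →
               (∀ l → IsInitialSegment _<I_ (Seg l)) →
               ∀ m c → IsInitialSegment _<I_ (⋃fin Seg m c)
⋃fin-initial initial m c s'≤s (p , s∈) = p , initial (c p) s'≤s s∈

⋃fin⊆⋃ : {I L : Set} (Seg : L → Subset I) {m : ℕ} {c : Fin (suc m) → L} →
         ∀ {i} → ⋃fin Seg m c i → ⋃ Seg i
⋃fin⊆⋃ Seg {c = c} (p , s) = c p , s

module Lexicographic {I : Set} (X : I → Set) (_<I_ : I → I → Set)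
                     (_<X_ : ∀ {i} → X i → X i → Set) where

  -- Lex does not determine the functions it compares, so these are often
  -- passed explicitly below.
  _<ₗ_ : {A : Subset I} → Π[_] X A → Π[_] X A → Set
  _<ₗ_ {A} = Lex X _<I_ _<X_ {A}

  restrict : {A B : Subset I} → (∀ {i} → A i → B i) → Π[_] X B → Π[_] X A
  restrict ι f = mkΠ (λ i a → app f i (ι a)) (λ i a a' → coh f i (ι a) (ι a'))

  restrict-< : {A B : Subset I} (ι : ∀ {i} → A i → B i) {f g : Π[_] X B} →
               (f<g : f <ₗ g) → A (proj₁ f<g) →
               restrict ι f <ₗ restrict ι g
  restrict-< ι {f} {g} (k , b , lt , agree) a =
    k , a , subst₂ _<X_ (coh f k b (ι a)) (coh g k b (ι a)) lt ,
    λ j a' j<k → agree j (ι a') j<k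

  extend-< : {A B : Subset I} (ι : ∀ {i} → A i → B i) →
             Transitive _<I_ → IsInitialSegment _<I_ A →
             {f g : Π[_] X B} → restrict ι f <ₗ restrict ι g → f <ₗ g
  extend-< ι <I-trans initial {f} {g} (k , a , lt , agree) =
    k , ι a , lt , λ j b j<k →
      let a' = initial (<⇒≤P <I-trans j<k) a
      in trans (coh f j b (ι a')) (trans (agree j a' j<k) (coh g j (ι a') b))

  <-irrefl : (∀ i → Asymmetric (_<X_ {i})) → {A : Subset I} {f : Π[_] X A} →
             ¬ (f <ₗ f)
  <-irrefl asym (k , _ , lt , _) = asym k lt lt

  <-posAntisymmetric : WellFounded _<I_ → (∀ i → IsGOS _≡_ (_<X_ {i})) →
                       (∀ i → Cotransitive (_<X_ {i})) →
                       {A : Subset I} → PosAntisymmetric (_≈Π_ X {A}) (_<ₗ_ {A})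
  <-posAntisymmetric wf gos cot {A} {f} {g} f≤g g≤f =
    All.wfRec wf _ (λ i → ∀ a → app f i a ≡ app g i a) agreeAt
    where
      ≮-at-key : ∀ {f g} → f ≤P⟨ _<ₗ_ {A} ⟩ g → ∀ i (a : A i) →
                 (∀ j b → j <I i → app g j b ≡ app f j b) →
                 ¬ (app g i a <X app f i a)
      ≮-at-key {f} {g} f≤g i a agree g<f =
        <-irrefl (λ k → IsGOS.asym (gos k)) {A} {g} (proj₁ (f≤g g) (i , a , g<f , agree))

      agreeAt : ∀ i → (∀ {j} → j <I i → ∀ b → app f j b ≡ app g j b) →
                ∀ a → app f i a ≡ app g i a
      agreeAt i below a = IsGOS.posAnti (gos i)
        (≮⇒≤P {_<_ = _<X_} (cot i) (≮-at-key {f} {g} f≤g i a λ j b j<i → sym (below j<i b)))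
        (≮⇒≤P {_<_ = _<X_} (cot i) (≮-at-key {g} {f} g≤f i a λ j b j<i → below j<i b))

module UnionOfSegments {I L : Set} (X : I → Set) (_<I_ : I → I → Set)
    (_<X_ : ∀ {i} → X i → X i → Set) (Seg : L → Subset I)
    (pairGOS : ∀ l l' → IsGOS (_≈Π_ X {⋃fin Seg 1 (l ∷ l' ∷ [])})
                              (Lex X _<I_ _<X_ {⋃fin Seg 1 (l ∷ l' ∷ [])})) where

  open Lexicographic X _<I_ _<X_

  private
    _∪_ : L → L → Subset I
    l ∪ l' = ⋃fin Seg 1 (l ∷ l' ∷ [])

    ι : ∀ {l l' i} → (l ∪ l') i → ⋃ Seg i
    ι = ⋃fin⊆⋃ Seg

    ↾ : ∀ {l l'} → Π[_] X (⋃ Seg) → Π[_] X (l ∪ l')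
    ↾ = restrict ι

  <-asym : Asymmetric (_<ₗ_ {⋃ Seg})
  <-asym {f} {g} f<g@(_ , (l , s) , _) g<f@(_ , (l' , s') , _) =
    IsGOS.asym (pairGOS l l') {↾ f} {↾ g}
      (restrict-< ι {f} {g} f<g (zero , s)) (restrict-< ι {g} {f} g<f (suc zero , s'))

  <-trans : Transitive _<I_ → (∀ l → IsInitialSegment _<I_ (Seg l)) →
            Transitive (_<ₗ_ {⋃ Seg})
  <-trans <I-trans initial {f} {g} {h} f<g@(_ , (l , s) , _) g<h@(_ , (l' , s') , _) =
    extend-< ι <I-trans (⋃fin-initial initial 1 (l ∷ l' ∷ [])) {f} {h}
      (IsGOS.trans (pairGOS l l') {↾ f} {↾ g} {↾ h}
        (restrict-< ι {f} {g} f<g (zero , s)) (restrict-< ι {g} {h} g<h (suc zero , s')))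

theorem22 : (I : Set) (_<I_ : I → I → Set) → IsOrdinal I _<I_ →
            (X : I → Set) (_<X_ : ∀ {i} → X i → X i → Set) →
            (∀ i → IsGOS (_≡_ {A = X i}) (_<X_ {i})) →
            (L : Set) (Seg : L → Subset I) →
            (∀ l → IsInitialSegment _<I_ (Seg l)) →
            (∀ (m : ℕ) (c : Fin (suc m) → L) →
               IsGOS (_≈Π_ X {⋃fin Seg m c}) (Lex X _<I_ _<X_ {⋃fin Seg m c})) →
            (Asymmetric (Lex X _<I_ _<X_ {⋃ Seg})
              × Transitive (Lex X _<I_ _<X_ {⋃ Seg}))
            × ((∀ i → Cotransitive (_<X_ {i})) →
               PosAntisymmetric (_≈Π_ X {⋃ Seg}) (Lex X _<I_ _<X_ {⋃ Seg}))
theorem22 I _<I_ ord X _<X_ gos L Seg initial finGOS =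
  ( (λ {f} {g} → <-asym {f} {g})
  , (λ {f} {g} {h} → <-trans (IsOrdinal.trans ord) initial {f} {g} {h}) )
  , λ cot {f} {g} → <-posAntisymmetric (IsOrdinal.wf ord) gos cot {⋃ Seg} {f} {g}
  where
    open UnionOfSegments X _<I_ _<X_ Seg (λ l l' → finGOS 1 (l ∷ l' ∷ []))
    open Lexicographic X _<I_ _<X_
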